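{- Let $\mathcal{R} = \{R_n\}_{n=0}^{\infty}$ and $\mathcal{H} = \{H_n\}_{n=0}^{\infty}$ be sequences of nonempty finite sets of positive integers such that \[ \lim_{n\rightarrow\infty} \frac{\max(H_n)}{n} = 0. \] Then there exists an $\mathcal{R}$-basis $A$ of order $\mathcal{H}$ if and only if for every $N$ there exists a finite $\mathcal{R}$-basis $A_N$ of order $\mathcal{H}$ with $\max(A_N) \geq N$.
   Context: For a set $A$ of nonnegative integers, a nonnegative integer $n$ and a positive integer $h$, $r_A(n,h)$ denotes the number of representations $n = a_1 + \cdots + a_h$ with $a_1,\ldots,a_h \in A$ and $a_1 \leq \cdots \leq a_h$; and $r_A(n,H_n) = \sum_{h_n \in H_n} r_A(n,h_n)$. A set $A$ of nonnegative integers is an $\mathcal{R}$-basis of order $\mathcal{H}$ if $r_A(n,H_n)\in R_n$ for all integers $n\ge 0$. A nonempty finite set $A$ of nonnegative integers is a finite $\mathcal{R}$-basis of order $\mathcal{H}$ if $r_A(n,H_n)\in R_n$ for all integers $n$ with $0\le n\le \max(A)$. -}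

module Defs where

open import Data.Bool using (Bool; true; false; _∧_)
open import Data.Nat using (ℕ; zero; suc; _+_; _*_; _≤_; _<_; _≤ᵇ_; _≡ᵇ_; _⊔_)
open import Data.List using (List; []; _∷_; [_]; map; concatMap; length; filterᵇ; upTo; foldr)
open import Data.Nat.ListAction using (sum)
open import Data.List.Membership.Propositional using (_∈_)
open import Data.List.Relation.Unary.All using (All)
open import Data.List.Relation.Unary.Unique.Propositional using (Unique)
open import Data.Product using (_×_; ∃)
open import Relation.Binary.PropositionalEquality using (_≡_; _≢_)

NatSet : Set
NatSet = ℕ → Bool

allLists : ℕ → List ℕ → List (List ℕ)
allLists zero    xs = [ [] ]
allLists (suc h) xs = concatMap (λ x → map (x ∷_) (allLists h xs)) xs

nondec : List ℕ → Bool
nondec []           = true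
nondec (x ∷ [])     = true
nondec (x ∷ y ∷ ys) = (x ≤ᵇ y) ∧ nondec (y ∷ ys)

allIn : NatSet → List ℕ → Bool
allIn A []       = true
allIn A (x ∷ xs) = A x ∧ allIn A xs

-- r_A(n,h): number of tuples (a₁,…,a_h) with aᵢ ∈ A, a₁ ≤ … ≤ a_h and
-- a₁ + … + a_h = n.  Every such aᵢ lies in {0,…,n}.
r : NatSet → ℕ → ℕ → ℕ
r A n h = length (filterᵇ (λ as → nondec as ∧ allIn A as ∧ (sum as ≡ᵇ n))
                          (allLists h (upTo (suc n))))

-- r_A(n, H) = Σ_{h ∈ H} r_A(n,h)   (H given as a duplicate-free list)
rH : NatSet → ℕ → List ℕ → ℕ
rH A n H = sum (map (r A n) H)

maxL : List ℕ → ℕ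
maxL = foldr _⊔_ 0

NonemptyFinPosSet : List ℕ → Set
NonemptyFinPosSet S = (S ≢ []) × All (λ x → 1 ≤ x) S × Unique S

-- lim_{n→∞} max(H_n)/n = 0, i.e. for every k ≥ 1 there is N with
-- max(H_n)/n < 1/k for all n ≥ N.
MaxRatioTendsToZero : (ℕ → List ℕ) → Set
MaxRatioTendsToZero H =
  (k : ℕ) → 1 ≤ k → ∃ λ N → (n : ℕ) → N ≤ n → k * maxL (H n) < n

IsRBasis : (R H : ℕ → List ℕ) → NatSet → Set
IsRBasis R H A = (n : ℕ) → rH A n (H n) ∈ R n

IsFiniteRBasis : (R H : ℕ → List ℕ) → NatSet → ℕ → Set
IsFiniteRBasis R H A m =
  (A m ≡ true) × ((k : ℕ) → m < k → A k ≡ false) ×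
  ((n : ℕ) → n ≤ m → rH A n (H n) ∈ R n)

-- A representation of n uses only elements ≤ n, so r_A(n, h) depends only on
-- A ∩ [0, n].  An R-basis A is infinite: if A ⊆ [0, N), pick n with
-- (N + 1)·max(H_n) < n; then every sum of h ∈ H_n elements of A is < n, so
-- r_A(n, H_n) = 0 ∉ R_n.  Truncating A at any element m ≥ N therefore gives a
-- finite R-basis with maximum m.  Conversely, by König's lemma on the binary
-- tree of initial segments, excluded middle lets us choose bit by bit an
-- infinite branch each of whose initial segments [0, L) is shared by finite
-- R-bases of arbitrarily large maximum; at n the branch agrees on [0, n] with
-- such a basis of maximum ≥ n, so it satisfies the condition at n.

{-# OPTIONS --safe #-}
module Submission where

open import Defs
open import Level using (0ℓ)
open import Axiom.ExcludedMiddle using (ExcludedMiddle)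
open import Axiom.DoubleNegationElimination using (em⇒dne)
open import Data.Bool using (Bool; true; false; _∧_; T; T?)
open import Data.Bool.Properties using (T-∧; T-≡; ∧-identityʳ; ∧-zeroʳ)
open import Data.Nat using (ℕ; suc; _*_; _≤_; _<_; _≤ᵇ_; _≡ᵇ_; _⊔_; z≤n; s≤s)
open import Data.Nat.Properties
open import Data.Nat.ListAction using (sum)
open import Data.List using (List; []; _∷_; map; length; filterᵇ)
open import Data.List.Properties using (filter-none; map-cong)
open import Data.List.Membership.Propositional using (_∈_)
open import Data.List.Relation.Unary.All as All using (All; []; _∷_)
open import Data.List.Relation.Unary.All.Properties using (map⁺; concat⁺; all-upTo)
open import Data.Product using (_×_; _,_; proj₁; proj₂; ∃; Σ)
open import Data.Sum using (inj₁; inj₂)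
open import Function using (_∘_)
open import Function.Bundles using (_⇔_; mk⇔; Equivalence)
open import Relation.Nullary using (¬_; yes; no; contradiction)
open import Relation.Binary.PropositionalEquality

AgreeBelow : ℕ → NatSet → NatSet → Set
AgreeBelow L A B = ∀ k → k < L → A k ≡ B k

AgreeBelow-mono : ∀ {L L' A B} → L ≤ L' → AgreeBelow L' A B → AgreeBelow L A B
AgreeBelow-mono L≤L' ag k k<L = ag k (<-≤-trans k<L L≤L')

AgreeBelow-trans : ∀ {L A B C} → AgreeBelow L A B → AgreeBelow L B C → AgreeBelow L A C
AgreeBelow-trans ab bc k k<L = trans (ab k k<L) (bc k k<L)

BoundedBy : ℕ → NatSet → Set
BoundedBy N A = ∀ k → A k ≡ true → k < N

represents : NatSet → ℕ → List ℕ → Bool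
represents A n as = nondec as ∧ allIn A as ∧ (sum as ≡ᵇ n)

T⇒≡true : ∀ {b} → T b → b ≡ true
T⇒≡true = Equivalence.to T-≡

All-allLists : ∀ {P : ℕ → Set} {xs} h → All P xs →
               All (λ as → All P as × length as ≡ h) (allLists h xs)
All-allLists 0 _ = ([] , refl) ∷ []
All-allLists {P} {xs} (suc h) pxs = concat⁺ (map⁺ (All.map prepend pxs))
  where
  prepend : ∀ {x} → P x →
            All (λ as → All P as × length as ≡ suc h) (map (x ∷_) (allLists h xs))
  prepend px = map⁺ (All.map (λ (pas , len) → px ∷ pas , cong suc len) (All-allLists h pxs))

filterᵇ-cong : ∀ {p q : List ℕ → Bool} {xss} →
               All (λ xs → p xs ≡ q xs) xss → filterᵇ p xss ≡ filterᵇ q xss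
filterᵇ-cong [] = refl
filterᵇ-cong {q = q} {xs ∷ _} (e ∷ es) rewrite e with q xs
... | true  = cong (xs ∷_) (filterᵇ-cong es)
... | false = filterᵇ-cong es

sum-≤-length* : ∀ {b as} → All (_≤ b) as → sum as ≤ length as * b
sum-≤-length* []       = z≤n
sum-≤-length* (p ∷ ps) = +-mono-≤ p (sum-≤-length* ps)

All-≤-maxL : ∀ xs → All (_≤ maxL xs) xs
All-≤-maxL []       = []
All-≤-maxL (x ∷ xs) =
  m≤m⊔n x (maxL xs) ∷ All.map (λ p → ≤-trans p (m≤n⊔m x (maxL xs))) (All-≤-maxL xs)

sum-map-zero : ∀ (f : ℕ → ℕ) {xs} → All (λ x → f x ≡ 0) xs → sum (map f xs) ≡ 0
sum-map-zero f []       = refl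
sum-map-zero f (e ∷ es) rewrite e = sum-map-zero f es

allIn-local : ∀ {L} {A B : NatSet} as → All (_< L) as → AgreeBelow L A B →
              allIn A as ≡ allIn B as
allIn-local []       []         _  = refl
allIn-local (k ∷ as) (k<L ∷ ps) ag = cong₂ _∧_ (ag k k<L) (allIn-local as ps ag)

r-local : ∀ {A B n} h → AgreeBelow (suc n) A B → r A n h ≡ r B n h
r-local {A} {B} {n} h ag =
  cong length (filterᵇ-cong (All.map same-verdict (All-allLists h (all-upTo (suc n)))))
  where
  same-verdict : ∀ {as} → All (_< suc n) as × length as ≡ h →
                 represents A n as ≡ represents B n as
  same-verdict {as} (bounded , _) =
    cong (λ inA → nondec as ∧ inA ∧ (sum as ≡ᵇ n)) (allIn-local as bounded ag)

rH-local : ∀ {A B n} Hs → AgreeBelow (suc n) A B → rH A n Hs ≡ rH B n Hs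
rH-local Hs ag = cong sum (map-cong (λ h → r-local h ag) Hs)

allIn⁻ : ∀ (A : NatSet) as → T (allIn A as) → All (λ k → A k ≡ true) as
allIn⁻ A []       _ = []
allIn⁻ A (k ∷ as) t =
  let (tk , tas) = Equivalence.to T-∧ t in T⇒≡true tk ∷ allIn⁻ A as tas

represents⁻ : ∀ A n as → T (represents A n as) → All (λ k → A k ≡ true) as × sum as ≡ n
represents⁻ A n as t =
  let (_ , inA&sum) = Equivalence.to (T-∧ {nondec as}) t
      (inA , sum≡n) = Equivalence.to (T-∧ {allIn A as}) inA&sum
  in allIn⁻ A as inA , ≡ᵇ⇒≡ (sum as) n sum≡n

r-vanishes : ∀ {N A n} h → BoundedBy N A → h * N < n → r A n h ≡ 0
r-vanishes {N} {A} {n} h bdd hN<n =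
  cong length (filter-none (T? ∘ represents A n)
    (All.map (λ {as} (_ , len) → unrepresented as len) (All-allLists h (all-upTo (suc n)))))
  where
  unrepresented : ∀ as → length as ≡ h → ¬ T (represents A n as)
  unrepresented as len t = <-irrefl sum≡n (begin-strict
      sum as            ≤⟨ sum-≤-length* (All.map (<⇒≤ ∘ bdd _) inA) ⟩
      length as * N     ≡⟨ cong (_* N) len ⟩
      h * N             <⟨ hN<n ⟩
      n                 ∎)
    where
    open ≤-Reasoning
    inA = proj₁ (represents⁻ A n as t)
    sum≡n = proj₂ (represents⁻ A n as t)

rH-vanishes : ∀ {N A n Hs} → BoundedBy N A → All (λ h → h * N < n) Hs → rH A n Hs ≡ 0
rH-vanishes {A = A} {n} bdd small = sum-map-zero (r A n) (All.map (λ {h} → r-vanishes h bdd) small)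

RBasis-unbounded : ∀ {R H A} N → (∀ n → All (1 ≤_) (R n)) → MaxRatioTendsToZero H →
                   IsRBasis R H A → ¬ BoundedBy N A
RBasis-unbounded {R} {H} N positive growth basis bdd =
  contradiction (subst (1 ≤_) (rH-vanishes bdd short) (All.lookup (positive n) (basis n))) λ ()
  where
  n : ℕ
  n = proj₁ (growth (suc N) (s≤s z≤n))
  short : All (λ h → h * N < n) (H n)
  short = All.map (λ {h} h≤max → begin-strict
      h * N                ≤⟨ *-mono-≤ h≤max (n≤1+n N) ⟩
      maxL (H n) * suc N   ≡⟨ *-comm (maxL (H n)) (suc N) ⟩
      suc N * maxL (H n)   <⟨ proj₂ (growth (suc N) (s≤s z≤n)) n ≤-refl ⟩
      n                    ∎) (All-≤-maxL (H n))
    where open ≤-Reasoning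

unbounded⇒∃-member : ExcludedMiddle 0ℓ → ∀ {N A} → ¬ BoundedBy N A → ∃ λ m → N ≤ m × A m ≡ true
unbounded⇒∃-member em ¬bdd =
  em⇒dne em λ ¬∃ → ¬bdd λ k Ak → ≰⇒> λ N≤k → ¬∃ (k , N≤k , Ak)

truncate : NatSet → ℕ → NatSet
truncate A m k = A k ∧ (k ≤ᵇ m)

truncate-agree : ∀ {A m} → AgreeBelow (suc m) A (truncate A m)
truncate-agree {A} {m} k (s≤s k≤m) rewrite T⇒≡true (≤⇒≤ᵇ k≤m) = sym (∧-identityʳ (A k))

truncate-above : ∀ {A m} k → m < k → truncate A m k ≡ false
truncate-above {A} {m} k m<k with k ≤ᵇ m in e
... | true  = contradiction (≤ᵇ⇒≤ k m (subst T (sym e) _)) (<⇒≱ m<k)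
... | false = ∧-zeroʳ (A k)

truncate-isFiniteRBasis : ∀ {R H A m} → IsRBasis R H A → A m ≡ true →
                          IsFiniteRBasis R H (truncate A m) m
truncate-isFiniteRBasis {R} {H} {A} {m} basis Am =
  trans (sym (truncate-agree {A} m ≤-refl)) Am , truncate-above , local-basis
  where
  local-basis : ∀ n → n ≤ m → rH (truncate A m) n (H n) ∈ R n
  local-basis n n≤m =
    subst (_∈ R n) (rH-local (H n) (AgreeBelow-mono (s≤s n≤m) truncate-agree)) (basis n)

updateAt : NatSet → ℕ → Bool → NatSet
updateAt s L b k with k ≟ L
... | yes _ = b
... | no  _ = s k

updateAt-≢ : ∀ s {L} b {k} → k ≢ L → updateAt s L b k ≡ s k
updateAt-≢ s {L} b {k} k≢L with k ≟ L
... | yes k≡L = contradiction k≡L k≢L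
... | no  _   = refl

AgreeBelow-updateAt : ∀ {L B s b} → AgreeBelow L B s → B L ≡ b →
                      AgreeBelow (suc L) B (updateAt s L b)
AgreeBelow-updateAt {L} ag BL k (s≤s k≤L) with k ≟ L
... | yes refl = BL
... | no  k≢L  = ag k (≤∧≢⇒< k≤L k≢L)

¬∀⇒∃¬ : ExcludedMiddle 0ℓ → ∀ {P : ℕ → Set} → ¬ (∀ N → P N) → ∃ λ N → ¬ P N
¬∀⇒∃¬ em ¬∀ = em⇒dne em λ ¬∃ → ¬∀ λ N → em⇒dne em λ ¬P → ¬∃ (N , ¬P)

Extendable : (ℕ → NatSet → Set) → ℕ → NatSet → Set
Extendable Q L s = ∀ N → Σ NatSet λ B → Q N B × AgreeBelow L B s

module Compactness (em : ExcludedMiddle 0ℓ) (Q : ℕ → NatSet → Set)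
                   (Q-antitone : ∀ {N N' B} → N ≤ N' → Q N' B → Q N B) where

  extend : ∀ {L s} → Extendable Q L s → Σ Bool λ b → Extendable Q (suc L) (updateAt s L b)
  extend {L} {s} ext with em {Extendable Q (suc L) (updateAt s L false)}
  ... | yes ext-false = false , ext-false
  ... | no ¬ext-false = true , ext-true
    where
    -- beyond N₀ no witness has B L ≡ false, so witnesses beyond N ⊔ N₀ have B L ≡ true
    N₀ : ℕ
    N₀ = proj₁ (¬∀⇒∃¬ em ¬ext-false)
    ext-true : Extendable Q (suc L) (updateAt s L true)
    ext-true N with ext (N ⊔ N₀)
    ... | B , q , ag with B L in BL
    ...   | true  = B , Q-antitone (m≤m⊔n N N₀) q , AgreeBelow-updateAt ag BL
    ...   | false = contradiction (B , Q-antitone (m≤n⊔m N N₀) q , AgreeBelow-updateAt ag BL)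
                                  (proj₂ (¬∀⇒∃¬ em ¬ext-false))

  module _ (nonempty : ∀ N → Σ NatSet (Q N)) where

    prefix : (L : ℕ) → Σ NatSet (Extendable Q L)
    prefix 0       = (λ _ → false) , λ N → proj₁ (nonempty N) , proj₂ (nonempty N) , λ _ ()
    prefix (suc L) = updateAt (proj₁ (prefix L)) L (proj₁ next) , proj₂ next
      where next = extend (proj₂ (prefix L))

    limit : NatSet
    limit k = proj₁ (prefix (suc k)) k

    prefix-agrees-limit : ∀ L → AgreeBelow L (proj₁ (prefix L)) limit
    prefix-agrees-limit (suc L) k (s≤s k≤L) with m≤n⇒m<n∨m≡n k≤L
    ... | inj₂ refl = refl
    ... | inj₁ k<L  = trans (updateAt-≢ _ _ (<⇒≢ k<L)) (prefix-agrees-limit L k k<L)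

    limit-extendable : ∀ L → Extendable Q L limit
    limit-extendable L N =
      let (B , q , ag) = proj₂ (prefix L) N
      in B , q , AgreeBelow-trans ag (prefix-agrees-limit L)

FiniteRBasisBeyond : (R H : ℕ → List ℕ) → ℕ → NatSet → Set
FiniteRBasisBeyond R H N A = ∃ λ m → N ≤ m × IsFiniteRBasis R H A m

RBasis⇒finiteRBases : ExcludedMiddle 0ℓ → ∀ R H → (∀ n → All (1 ≤_) (R n)) →
                      MaxRatioTendsToZero H → Σ NatSet (IsRBasis R H) →
                      ∀ N → Σ NatSet (FiniteRBasisBeyond R H N)
RBasis⇒finiteRBases em R H positive growth (A , basis) N =
  let (m , N≤m , Am) = unbounded⇒∃-member em (RBasis-unbounded {H = H} N positive growth basis)
  in truncate A m , m , N≤m , truncate-isFiniteRBasis {H = H} basis Am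

finiteRBases⇒RBasis : ExcludedMiddle 0ℓ → ∀ R H → (∀ N → Σ NatSet (FiniteRBasisBeyond R H N)) →
                      Σ NatSet (IsRBasis R H)
finiteRBases⇒RBasis em R H finite = limit finite , basis
  where
  open Compactness em (FiniteRBasisBeyond R H) (λ N≤N' (m , N'≤m , fin) → m , ≤-trans N≤N' N'≤m , fin)
  basis : IsRBasis R H (limit finite)
  basis n =
    let (B , (m , n≤m , (_ , _ , finite-basis)) , ag) = limit-extendable finite (suc n) n
    in subst (_∈ R n) (rH-local (H n) ag) (finite-basis n n≤m)

theorem4 : ExcludedMiddle 0ℓ →
    (R H : ℕ → List ℕ) →
    ((n : ℕ) → NonemptyFinPosSet (R n)) →
    ((n : ℕ) → NonemptyFinPosSet (H n)) →
    MaxRatioTendsToZero H →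
    (Σ NatSet (λ A → IsRBasis R H A))
      ⇔ ((N : ℕ) → Σ NatSet (λ A → ∃ λ m → N ≤ m × IsFiniteRBasis R H A m))
theorem4 em R H R-sets _ growth =
  mk⇔ (RBasis⇒finiteRBases em R H (proj₁ ∘ proj₂ ∘ R-sets) growth) (finiteRBases⇒RBasis em R H)
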